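{- Let $n\ge 2$ and $s>n$. Then the Cantorian minimal reduced tableaux in $\mathcal{T}^s_n$ are exactly the Cantorian minimal reduced tableaux in $\mathcal{T}^n_n$. Here $\mathcal{T}^n_n$ is the set of $n\times n$ tableaux over the first $n$ letters $\{\alpha_1,\dots,\alpha_n\}$ of $A$.
   Context: Let $A=\{\alpha_1<\dots<\alpha_s\}$ be an ordered alphabet. $\mathcal{T}^s_n$ is the set of $n\times n$ tableaux with entries in $A$. For a tableau $T$, $L$ is the set of its row-words (read left to right). The permanent of $T=(a_i^j)$, with row index $i$ and column index $j$, is $\mathrm{Perm}(T)=\{a^1_{\pi(1)}a^2_{\pi(2)}\cdots a^n_{\pi(n)}:\pi\in S_n\}$. $T$ is Cantorian if $\mathrm{Perm}(T)\cap L=\emptyset$. Define $T'\sim_{\mathbf c}T$ iff $T'$ is obtained from $T$ by a finite sequence of the following operations: permuting rows, permuting columns, and applying a bijection of $A$ to all entries of one column. Orders. For $w\in A^\star$, $\mathfrak{p}(w)=|w|_{\alpha_1}\cdots|w|_{\alpha_s}$, where $|w|_\alpha$ counts occurrences of $\alpha$. On sequences of natural numbers, $\lambda\preceq\lambda'$ iff $\ell(\lambda)<\ell(\lambda')$, or the lengths are equal and $\lambda'\le\lambda$ lexicographically. On words, $w\blacktriangleleft w'$ iff $\mathfrak{p}(w)\prec\mathfrak{p}(w')$, or $\mathfrak{p}(w)=\mathfrak{p}(w')$ and $w\le w'$ lexicographically. Tableaux are ordered by $\blacktriangleleft$ applied lexicographically to their sequence of column-words $(c_1,\dots,c_n)$,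 compared from left to right. A minimal reduced tableau is a tableau $T$ with $T\blacktriangleleft T'$ for every $T'\sim_{\mathbf c}T$, i.e. the least element of its $\sim_{\mathbf c}$-class. -}

module Defs where

open import Data.Nat using (ℕ; _<_; _≤_)
open import Data.Fin using (Fin; toℕ; inject≤; _≟_)
open import Data.Fin.Permutation using (Permutation′; _⟨$⟩ʳ_)
open import Data.List using (List; []; _∷_; length; filter; tabulate)
open import Data.Product using (Σ; _×_)
open import Data.Sum using (_⊎_)
open import Data.Bool using (if_then_else_)
open import Relation.Nullary using (¬_)
open import Relation.Nullary.Decidable using (⌊_⌋)
open import Relation.Binary.PropositionalEquality using (_≡_; _≢_)
open import Relation.Binary.Construct.Closure.ReflexiveTransitive using (Star)

-- An n×n tableau over the alphabet A = Fin s (α_{k+1} ↦ k, ordered as Fin).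
-- T i j = a_i^j : row index i, column index j.
Tableau : ℕ → ℕ → Set
Tableau s n = Fin n → Fin n → Fin s

Word : ℕ → Set
Word s = List (Fin s)

row : ∀ {s n} → Tableau s n → Fin n → Word s
row T i = tabulate (λ j → T i j)

col : ∀ {s n} → Tableau s n → Fin n → Word s
col T j = tabulate (λ i → T i j)

permWord : ∀ {s n} → Tableau s n → Permutation′ n → Word s
permWord T π = tabulate (λ j → T (π ⟨$⟩ʳ j) j)

Cantorian : ∀ {s n} → Tableau s n → Set
Cantorian {n = n} T = (π : Permutation′ n) (i : Fin n) → permWord T π ≢ row T i

data Step {s n : ℕ} : Tableau s n → Tableau s n → Set where
  rowPerm : (T : Tableau s n) (σ : Permutation′ n) → Step T (λ i j → T (σ ⟨$⟩ʳ i) j)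
  colPerm : (T : Tableau s n) (σ : Permutation′ n) → Step T (λ i j → T i (σ ⟨$⟩ʳ j))
  colBij  : (T : Tableau s n) (j₀ : Fin n) (f : Permutation′ s) →
            Step T (λ i j → if ⌊ j ≟ j₀ ⌋ then f ⟨$⟩ʳ T i j else T i j)

_∼c_ : ∀ {s n} → Tableau s n → Tableau s n → Set
_∼c_ = Star Step

-- non-strict lexicographic extension of a strict order (a proper prefix is smaller)
data Lex {A : Set} (_<ᵣ_ : A → A → Set) : List A → List A → Set where
  base : ∀ {ys} → Lex _<ᵣ_ [] ys
  this : ∀ {x y xs ys} → x <ᵣ y → Lex _<ᵣ_ (x ∷ xs) (y ∷ ys)
  next : ∀ {x xs ys} → Lex _<ᵣ_ xs ys → Lex _<ᵣ_ (x ∷ xs) (x ∷ ys)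

count : ∀ {s} → Fin s → Word s → ℕ
count a w = length (filter (_≟ a) w)

𝔭 : ∀ {s} → Word s → List ℕ
𝔭 w = tabulate (λ a → count a w)

_⪯_ : List ℕ → List ℕ → Set
l ⪯ l' = (length l < length l') ⊎ ((length l ≡ length l') × Lex _<_ l' l)

_≺_ : List ℕ → List ℕ → Set
l ≺ l' = (l ⪯ l') × (l ≢ l')

_<F_ : ∀ {s} → Fin s → Fin s → Set
a <F b = toℕ a < toℕ b

_◀_ : ∀ {s} → Word s → Word s → Set
w ◀ w' = (𝔭 w ≺ 𝔭 w') ⊎ ((𝔭 w ≡ 𝔭 w') × Lex _<F_ w w')

_◁_ : ∀ {s} → Word s → Word s → Set
w ◁ w' = (w ◀ w') × (w ≢ w')

cols : ∀ {s n} → Tableau s n → List (Word s)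
cols T = tabulate (col T)

_◀T_ : ∀ {s n} → Tableau s n → Tableau s n → Set
T ◀T T' = Lex _◁_ (cols T) (cols T')

MinimalReduced : ∀ {s n} → Tableau s n → Set
MinimalReduced T = ∀ T' → T ∼c T' → T ◀T T'

CantorianMinimalReduced : ∀ {s n} → Tableau s n → Set
CantorianMinimalReduced T = Cantorian T × MinimalReduced T

-- view a tableau over {α₁,…,αₙ} as a tableau over A = {α₁,…,α_s}
embed : ∀ {m s n} → m ≤ s → Tableau m n → Tableau s n
embed m≤s T i j = inject≤ (T i j) m≤s

-- ∼c has an alphabet-free description: T ∼c T′ iff, after a row and a column permutation,
-- corresponding columns of T and T′ have the same pattern of equal entries. Hence viewing a tableau
-- over {α₁,…,αₙ} as one over A preserves and reflects ∼c, and also ◀T, since it only appends zeros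
-- to every 𝔭. A column has n entries, so if it contains a letter beyond αₙ it misses some αₖ with
-- k ≤ n, and exchanging these two letters in that column strictly lowers the column. Thus a minimal
-- reduced tableau uses only α₁,…,αₙ; conversely, repeating the exchange moves any tableau of the
-- ∼c-class of a tableau over {α₁,…,αₙ} down to a tableau over {α₁,…,αₙ} of the same class.

module Submission where

open import Defs
open import Data.Nat using (ℕ; _≤_; _<_)
open import Data.Nat.Properties using (<⇒≤)
open import Data.Fin using (Fin)
open import Data.Product using (Σ; _×_)
open import Function.Bundles using (_⇔_)
open import Relation.Binary.PropositionalEquality using (_≡_)

open import Data.Bool using (if_then_else_)
open import Data.Empty using (⊥-elim)
open import Data.Fin as Fin using (toℕ; inject≤; _≟_; _↑ˡ_; _↑ʳ_)
import Data.Fin.Properties as Fin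
open import Data.Fin.Permutation as Perm
  using (Permutation′; _⟨$⟩ʳ_; _⟨$⟩ˡ_; _∘ₚ_; transpose; inverseˡ)
open import Data.List using (List; []; _∷_; _++_; length; map; tabulate)
import Data.List.Properties as List
open import Data.List.Relation.Unary.All as All using (All)
import Data.List.Relation.Unary.All.Properties as All
open import Data.List.Relation.Unary.Any using (Any)
import Data.List.Relation.Unary.Any.Properties as Any
open import Data.Nat as ℕ using (zero; suc; _+_)
import Data.Nat.Induction as ℕ
import Data.Nat.Properties as ℕ
open import Data.Product using (_,_; proj₁; proj₂; ∃)
open import Data.Sum using (_⊎_; inj₁; inj₂; [_,_]′)
import Data.Vec.Functional as Vector
open import Function using (_∘_)
open import Function.Bundles using (Equivalence; mk⇔)
open import Function.Definitions using (Injective)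
import Function.Properties.Equivalence as ⇔
open import Induction.WellFounded using (Acc; acc)
open import Relation.Binary.Construct.Closure.ReflexiveTransitive using (ε; _◅_; _◅◅_)
open import Relation.Binary.Definitions using (Transitive; Antisymmetric; Asymmetric)
open import Relation.Binary.PropositionalEquality
  using (_≢_; refl; sym; trans; cong; cong₂; subst; subst₂)
open import Relation.Nullary using (¬_; Dec; yes; no)
open import Relation.Nullary.Decidable using (⌊_⌋; dec-true; dec-false)

private variable
  A B : Set
  m n s : ℕ

-- Lexicographic orders

tabulate-injective : {f g : Fin n → A} → tabulate f ≡ tabulate g → ∀ i → f i ≡ g i
tabulate-injective {suc n} e Fin.zero    = List.∷-injectiveˡ e
tabulate-injective {suc n} e (Fin.suc i) = tabulate-injective (List.∷-injectiveʳ e) i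

module _ {_<ᵣ_ : A → A → Set} where

  Lex-refl : ∀ xs → Lex _<ᵣ_ xs xs
  Lex-refl []       = base
  Lex-refl (x ∷ xs) = next (Lex-refl xs)

  Lex-trans : Transitive _<ᵣ_ → Transitive (Lex _<ᵣ_)
  Lex-trans t base     _         = base
  Lex-trans t (this r) (this r′) = this (t r r′)
  Lex-trans t (this r) (next _)  = this r
  Lex-trans t (next _) (this r)  = this r
  Lex-trans t (next l) (next l′) = next (Lex-trans t l l′)

  Lex-antisym : Asymmetric _<ᵣ_ → Antisymmetric _≡_ (Lex _<ᵣ_)
  Lex-antisym a base     base      = refl
  Lex-antisym a (this r) (this r′) = ⊥-elim (a r r′)
  Lex-antisym a (this r) (next _)  = ⊥-elim (a r r)
  Lex-antisym a (next _) (this r)  = ⊥-elim (a r r)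
  Lex-antisym a (next l) (next l′) = cong (_ ∷_) (Lex-antisym a l l′)

  Lex-uncons : ∀ {x y xs ys} → Lex _<ᵣ_ (x ∷ xs) (y ∷ ys) → x <ᵣ y ⊎ (x ≡ y × Lex _<ᵣ_ xs ys)
  Lex-uncons (this r) = inj₁ r
  Lex-uncons (next l) = inj₂ (refl , l)

  tabulate-Lex-pointwise : {f g : Fin n → A} → (∀ k → f k ≡ g k ⊎ f k <ᵣ g k) →
                           Lex _<ᵣ_ (tabulate f) (tabulate g)
  tabulate-Lex-pointwise {zero}  h = base
  tabulate-Lex-pointwise {suc n} h with h Fin.zero
  ... | inj₂ r    = this r
  ... | inj₁ e rewrite e = next (tabulate-Lex-pointwise (h ∘ Fin.suc))

  tabulate-Lex-pointwise-strict : Asymmetric _<ᵣ_ → {f g : Fin n → A} → (∀ k → f k ≡ g k ⊎ f k <ᵣ g k) →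
                                  ∀ j → f j <ᵣ g j → ¬ Lex _<ᵣ_ (tabulate g) (tabulate f)
  tabulate-Lex-pointwise-strict asym {g = g} f⊴g j fj<gj g≤f = asym gj<gj gj<gj
    where
    gj<gj : g j <ᵣ g j
    gj<gj = subst (_<ᵣ g j) (tabulate-injective (Lex-antisym asym (tabulate-Lex-pointwise f⊴g) g≤f) j) fj<gj

  tabulate-Lex-first : {f g : Fin n → A} (j : Fin n) → (∀ k → k Fin.< j → f k ≡ g k) → f j <ᵣ g j →
                       Lex _<ᵣ_ (tabulate f) (tabulate g)
  tabulate-Lex-first {suc n} Fin.zero    h r = this r
  tabulate-Lex-first {suc n} (Fin.suc j) h r rewrite h Fin.zero ℕ.z<s =
    next (tabulate-Lex-first j (λ k k<j → h (Fin.suc k) (ℕ.s<s k<j)) r)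

  Lex-++⁺ : ∀ {xs ys} zs → length xs ≡ length ys → Lex _<ᵣ_ xs ys → Lex _<ᵣ_ (xs ++ zs) (ys ++ zs)
  Lex-++⁺ {[]}     {[]}     zs _ _        = Lex-refl zs
  Lex-++⁺ {_ ∷ _}  {_ ∷ _}  zs _ (this r) = this r
  Lex-++⁺ {_ ∷ _}  {_ ∷ _}  zs e (next l) = next (Lex-++⁺ zs (ℕ.suc-injective e) l)

  Lex-++⁻ : ∀ {xs ys} zs → length xs ≡ length ys → Lex _<ᵣ_ (xs ++ zs) (ys ++ zs) → Lex _<ᵣ_ xs ys
  Lex-++⁻ {[]}     {[]}     zs _ _        = base
  Lex-++⁻ {_ ∷ _}  {_ ∷ _}  zs _ (this r) = this r
  Lex-++⁻ {_ ∷ _}  {_ ∷ _}  zs e (next l) = next (Lex-++⁻ zs (ℕ.suc-injective e) l)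

module _ {_<ᵣ_ : A → A → Set} {_<ₛ_ : B → B → Set} {f : A → B} where

  Lex-map⁺ : (∀ {x y} → x <ᵣ y → f x <ₛ f y) →
             ∀ {xs ys} → Lex _<ᵣ_ xs ys → Lex _<ₛ_ (map f xs) (map f ys)
  Lex-map⁺ mono base     = base
  Lex-map⁺ mono (this r) = this (mono r)
  Lex-map⁺ mono (next l) = next (Lex-map⁺ mono l)

  Lex-map⁻ : Injective _≡_ _≡_ f → (∀ {x y} → f x <ₛ f y → x <ᵣ y) →
             ∀ xs {ys} → Lex _<ₛ_ (map f xs) (map f ys) → Lex _<ᵣ_ xs ys
  Lex-map⁻ inj reflect []       l = base
  Lex-map⁻ inj reflect (x ∷ xs) {y ∷ ys} l with Lex-uncons l
  ... | inj₁ r        = this (reflect r)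
  ... | inj₂ (e , l′) rewrite inj e = next (Lex-map⁻ inj reflect xs l′)

⪯-trans : Transitive _⪯_
⪯-trans (inj₁ p)       (inj₁ q)        = inj₁ (ℕ.<-trans p q)
⪯-trans (inj₁ p)       (inj₂ (e , _))  = inj₁ (subst (_ <_) e p)
⪯-trans (inj₂ (e , _)) (inj₁ q)        = inj₁ (subst (_< _) (sym e) q)
⪯-trans (inj₂ (e , l)) (inj₂ (e′ , l′)) = inj₂ (trans e e′ , Lex-trans ℕ.<-trans l′ l)

⪯-antisym : Antisymmetric _≡_ _⪯_
⪯-antisym (inj₁ p)       (inj₁ q)        = ⊥-elim (ℕ.<-asym p q)
⪯-antisym (inj₁ p)       (inj₂ (e , _))  = ⊥-elim (ℕ.<-irrefl (sym e) p)
⪯-antisym (inj₂ (e , _)) (inj₁ q)        = ⊥-elim (ℕ.<-irrefl (sym e) q)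
⪯-antisym (inj₂ (_ , l)) (inj₂ (_ , l′)) = Lex-antisym ℕ.<-asym l′ l

⪯-sameLength⇒Lex : ∀ {l l′} → length l ≡ length l′ → l ⪯ l′ → Lex _<_ l′ l
⪯-sameLength⇒Lex e (inj₁ p)       = ⊥-elim (ℕ.<-irrefl e p)
⪯-sameLength⇒Lex e (inj₂ (_ , l)) = l

≺-trans : Transitive _≺_
≺-trans (p , neq) (q , _) = ⪯-trans p q , λ { refl → neq (⪯-antisym p q) }

𝔭-length : (w : Word s) → length (𝔭 w) ≡ s
𝔭-length w = List.length-tabulate _

module _ {s : ℕ} where

  ◀-trans : Transitive (_◀_ {s})
  ◀-trans (inj₁ p)       (inj₁ q)        = inj₁ (≺-trans p q)
  ◀-trans (inj₁ p)       (inj₂ (e , _))  = inj₁ (subst (_ ≺_) e p)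
  ◀-trans (inj₂ (e , _)) (inj₁ q)        = inj₁ (subst (_≺ _) (sym e) q)
  ◀-trans (inj₂ (e , l)) (inj₂ (e′ , l′)) = inj₂ (trans e e′ , Lex-trans ℕ.<-trans l l′)

  ◀-antisym : Antisymmetric _≡_ (_◀_ {s})
  ◀-antisym (inj₁ (p , neq)) (inj₁ (q , _)) = ⊥-elim (neq (⪯-antisym p q))
  ◀-antisym (inj₁ (_ , neq)) (inj₂ (e , _)) = ⊥-elim (neq (sym e))
  ◀-antisym (inj₂ (e , _)) (inj₁ (_ , neq)) = ⊥-elim (neq (sym e))
  ◀-antisym (inj₂ (_ , l)) (inj₂ (_ , l′)) = Lex-antisym ℕ.<-asym l l′

  ◁-trans : Transitive (_◁_ {s})
  ◁-trans (p , neq) (q , _) = ◀-trans p q , λ { refl → neq (◀-antisym p q) }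

  ◁-asym : Asymmetric (_◁_ {s})
  ◁-asym (p , neq) (q , _) = neq (◀-antisym p q)

◀T-trans : Transitive (_◀T_ {s} {n})
◀T-trans = Lex-trans ◁-trans

-- Letter counts and the alphabet embedding

count-absent : ∀ {k : Fin s} {w} → All (_≢ k) w → count k w ≡ 0
count-absent none = cong length (List.filter-none (_≟ _) none)

count-present : ∀ {k : Fin s} {w} → Any (_≡ k) w → 0 < count k w
count-present = List.filter-some (_≟ _)

count-map : (f : Fin m → Fin s) {k : Fin s} {k′ : Fin m} → (∀ x → f x ≡ k ⇔ x ≡ k′) →
            ∀ w → count k (map f w) ≡ count k′ w
count-map f {k} {k′} hit [] = refl
count-map f {k} {k′} hit (x ∷ w) with f x ≟ k | x ≟ k′
... | yes _  | yes _  = cong suc (count-map f hit w)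
... | yes fx | no ¬x  = ⊥-elim (¬x (Equivalence.to (hit x) fx))
... | no ¬fx | yes x′ = ⊥-elim (¬fx (Equivalence.from (hit x) x′))
... | no _   | no _   = count-map f hit w

tabulate-++ : ∀ m k (f : Fin (m + k) → A) →
              tabulate f ≡ tabulate (f ∘ (_↑ˡ k)) ++ tabulate (f ∘ (m ↑ʳ_))
tabulate-++ zero    k f = refl
tabulate-++ (suc m) k f = cong (f Fin.zero ∷_) (tabulate-++ m k (f ∘ Fin.suc))

inject≤≡↑ˡ : ∀ {k} (x : Fin n) (p : n ≤ n + k) → inject≤ x p ≡ x ↑ˡ k
inject≤≡↑ˡ {k = k} x p = Fin.toℕ-injective (trans (Fin.toℕ-inject≤ x p) (sym (Fin.toℕ-↑ˡ x k)))

inject≤-fromℕ< : (p : n ≤ s) {x : Fin s} (x<n : toℕ x < n) → inject≤ (Fin.fromℕ< x<n) p ≡ x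
inject≤-fromℕ< p x<n = Fin.toℕ-injective (trans (Fin.toℕ-inject≤ _ p) (Fin.toℕ-fromℕ< x<n))

↑ˡ≢↑ʳ : ∀ {k} (x : Fin n) (b : Fin k) → x ↑ˡ k ≢ n ↑ʳ b
↑ˡ≢↑ʳ {n} {k} x b e
  with () ← trans (sym (Fin.splitAt-↑ˡ n x k)) (trans (cong (Fin.splitAt n) e) (Fin.splitAt-↑ʳ n k b))

𝔭-map-inject≤ : (p : n ≤ s) → ∃ λ zs → ∀ w → 𝔭 (map (λ x → inject≤ x p) w) ≡ 𝔭 w ++ zs
𝔭-map-inject≤ {n} p with k , refl ← ℕ.m≤n⇒∃[o]m+o≡n p = tabulate (λ _ → 0) , λ w →
  trans (tabulate-++ n k _)
        (cong₂ _++_ (List.tabulate-cong (λ a → count-map ι (λ x → hit x a) w))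
                    (List.tabulate-cong (λ b → count-absent (All.map⁺ (All.universal (miss b) w)))))
  where
  ι : Fin n → Fin (n + k)
  ι x = inject≤ x p
  hit : ∀ x a → ι x ≡ a ↑ˡ k ⇔ x ≡ a
  hit x a = mk⇔ (Fin.↑ˡ-injective k x a ∘ trans (sym (inject≤≡↑ˡ x p))) λ { refl → inject≤≡↑ˡ x p }
  miss : ∀ b x → ι x ≢ n ↑ʳ b
  miss b x = ↑ˡ≢↑ʳ x b ∘ trans (sym (inject≤≡↑ˡ x p))

module _ (p : n ≤ s) where

  private
    ι : Fin n → Fin s
    ι x = inject≤ x p

    ι-injective : Injective _≡_ _≡_ ι
    ι-injective = Fin.inject≤-injective p p _ _

    zs : List ℕ
    zs = proj₁ (𝔭-map-inject≤ p)

    𝔭ι : ∀ w → 𝔭 (map ι w) ≡ 𝔭 w ++ zs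
    𝔭ι = proj₂ (𝔭-map-inject≤ p)

    sameLength : ∀ {r} (u v : Word r) → length (𝔭 u) ≡ length (𝔭 v)
    sameLength u v = trans (𝔭-length u) (sym (𝔭-length v))

    𝔭-≡⁺ : ∀ {u v} → 𝔭 u ≡ 𝔭 v → 𝔭 (map ι u) ≡ 𝔭 (map ι v)
    𝔭-≡⁺ {u} {v} e = trans (𝔭ι u) (trans (cong (_++ zs) e) (sym (𝔭ι v)))

    𝔭-≡⁻ : ∀ {u v} → 𝔭 (map ι u) ≡ 𝔭 (map ι v) → 𝔭 u ≡ 𝔭 v
    𝔭-≡⁻ {u} {v} e = List.++-cancelʳ zs (𝔭 u) (𝔭 v) (trans (sym (𝔭ι u)) (trans e (𝔭ι v)))

    𝔭-≺⁺ : ∀ {u v} → 𝔭 u ≺ 𝔭 v → 𝔭 (map ι u) ≺ 𝔭 (map ι v)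
    𝔭-≺⁺ {u} {v} (le , neq) =
      inj₂ (sameLength (map ι u) (map ι v) ,
            subst₂ (Lex _<_) (sym (𝔭ι v)) (sym (𝔭ι u))
                   (Lex-++⁺ zs (sameLength v u) (⪯-sameLength⇒Lex (sameLength u v) le))) ,
      neq ∘ 𝔭-≡⁻ {u} {v}

    𝔭-≺⁻ : ∀ {u v} → 𝔭 (map ι u) ≺ 𝔭 (map ι v) → 𝔭 u ≺ 𝔭 v
    𝔭-≺⁻ {u} {v} (le , neq) =
      inj₂ (sameLength u v ,
            Lex-++⁻ zs (sameLength v u)
                    (subst₂ (Lex _<_) (𝔭ι v) (𝔭ι u) (⪯-sameLength⇒Lex (sameLength (map ι u) (map ι v)) le))) ,
      neq ∘ 𝔭-≡⁺ {u} {v}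

    ι-<F : ∀ {x y} → x <F y ⇔ ι x <F ι y
    ι-<F {x} {y} = mk⇔ (subst₂ _<_ (sym (Fin.toℕ-inject≤ x p)) (sym (Fin.toℕ-inject≤ y p)))
                       (subst₂ _<_ (Fin.toℕ-inject≤ x p) (Fin.toℕ-inject≤ y p))

  ◁-map-inject≤ : ∀ {u v} → u ◁ v ⇔ map ι u ◁ map ι v
  ◁-map-inject≤ {u} {v} = mk⇔ to from
    where
    to : u ◁ v → map ι u ◁ map ι v
    to (inj₁ q , neq)       = inj₁ (𝔭-≺⁺ {u} {v} q) , neq ∘ List.map-injective ι-injective
    to (inj₂ (e , l) , neq) =
      inj₂ (𝔭-≡⁺ {u} {v} e , Lex-map⁺ (Equivalence.to ι-<F) l) , neq ∘ List.map-injective ι-injective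
    from : map ι u ◁ map ι v → u ◁ v
    from (inj₁ q , neq)       = inj₁ (𝔭-≺⁻ {u} {v} q) , neq ∘ cong (map ι)
    from (inj₂ (e , l) , neq) =
      inj₂ (𝔭-≡⁻ {u} {v} e , Lex-map⁻ ι-injective (Equivalence.from ι-<F) u l) , neq ∘ cong (map ι)

  cols-embed : (X : Tableau n m) → cols (embed p X) ≡ map (map ι) (cols X)
  cols-embed X = sym (trans (List.map-tabulate _ _) (List.tabulate-cong (λ j → List.map-tabulate _ _)))

  ◀T-embed : {X Y : Tableau n m} → X ◀T Y ⇔ embed p X ◀T embed p Y
  ◀T-embed {X = X} {Y} = mk⇔
    (subst₂ (Lex _◁_) (sym (cols-embed X)) (sym (cols-embed Y)) ∘ Lex-map⁺ (Equivalence.to ◁-map-inject≤))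
    (Lex-map⁻ (List.map-injective ι-injective) (Equivalence.from ◁-map-inject≤) (cols X)
      ∘ subst₂ (Lex _◁_) (cols-embed X) (cols-embed Y))

-- Column patterns and the relation ∼c

⟨$⟩ʳ-injective : (π : Permutation′ m) → Injective _≡_ _≡_ (π ⟨$⟩ʳ_)
⟨$⟩ʳ-injective π e = trans (sym (inverseˡ π)) (trans (cong (π ⟨$⟩ˡ_) e) (inverseˡ π))

transpose-matchˡ : (a b : Fin m) → transpose a b ⟨$⟩ʳ a ≡ b
transpose-matchˡ a b rewrite dec-true (a ≟ a) refl = refl

transpose-fixed : ∀ {a b x : Fin m} → x ≢ a → x ≢ b → transpose a b ⟨$⟩ʳ x ≡ x
transpose-fixed {a = a} {b} {x} x≢a x≢b rewrite dec-false (x ≟ a) x≢a | dec-false (x ≟ b) x≢b = refl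

SamePattern : (Fin n → Fin m) → (Fin n → Fin s) → Set
SamePattern c d = ∀ i i′ → c i ≡ c i′ ⇔ d i ≡ d i′

module _ {c : Fin n → Fin m} where

  SamePattern-refl : SamePattern c c
  SamePattern-refl i i′ = ⇔.refl

  SamePattern-sym : {d : Fin n → Fin s} → SamePattern c d → SamePattern d c
  SamePattern-sym pat i i′ = ⇔.sym (pat i i′)

  SamePattern-trans : ∀ {r} {d : Fin n → Fin s} {e : Fin n → Fin r} →
                      SamePattern c d → SamePattern d e → SamePattern c e
  SamePattern-trans pat pat′ i i′ = ⇔.trans (pat i i′) (pat′ i i′)

  SamePattern-injective : {f : Fin m → Fin s} → Injective _≡_ _≡_ f → SamePattern c (f ∘ c)
  SamePattern-injective {f = f} inj i i′ = mk⇔ (cong f) inj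

  SamePattern-respˡ : ∀ {c′ : Fin n → Fin m} {d : Fin n → Fin s} → (∀ i → c i ≡ c′ i) →
                      SamePattern c d → SamePattern c′ d
  SamePattern-respˡ c≗c′ pat i i′ =
    ⇔.trans (mk⇔ (λ e → trans (c≗c′ i) (trans e (sym (c≗c′ i′))))
                 (λ e → trans (sym (c≗c′ i)) (trans e (c≗c′ i′))))
            (pat i i′)

SamePattern-respʳ : {c : Fin n → Fin m} {d d′ : Fin n → Fin s} → (∀ i → d i ≡ d′ i) →
                    SamePattern c d → SamePattern c d′
SamePattern-respʳ d≗d′ pat = SamePattern-sym (SamePattern-respˡ d≗d′ (SamePattern-sym pat))

-- Induction on the rows: if the first letter of c is new, a transposition sends its image under g to d 0
-- without moving any other image.
samePattern⇒recolouring : ∀ {n m} {c d : Fin n → Fin m} → SamePattern c d →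
                          ∃ λ (g : Permutation′ m) → ∀ i → g ⟨$⟩ʳ c i ≡ d i
samePattern⇒recolouring {zero} _ = Perm.id , λ ()
samePattern⇒recolouring {suc n} {m} {c} {d} pat
  with g , g-ok ← samePattern⇒recolouring {c = c ∘ Fin.suc} {d ∘ Fin.suc} (λ i i′ → pat (Fin.suc i) (Fin.suc i′))
  with Fin.any? (λ i → c (Fin.suc i) ≟ c Fin.zero)
... | yes (i₀ , c₀-repeated) = g , λ
  { Fin.zero    → trans (cong (g ⟨$⟩ʳ_) (sym c₀-repeated))
                        (trans (g-ok i₀) (Equivalence.to (pat (Fin.suc i₀) Fin.zero) c₀-repeated))
  ; (Fin.suc i) → g-ok i }
... | no c₀-new = g ∘ₚ τ , λ
  { Fin.zero    → transpose-matchˡ (g ⟨$⟩ʳ c Fin.zero) (d Fin.zero)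
  ; (Fin.suc i) → trans (cong (τ ⟨$⟩ʳ_) (g-ok i))
                        (transpose-fixed (λ e → c₀-new (i , ⟨$⟩ʳ-injective g (trans (g-ok i) e)))
                                         (λ e → c₀-new (i , Equivalence.from (pat (Fin.suc i) Fin.zero) e))) }
  where
  τ : Permutation′ m
  τ = transpose (g ⟨$⟩ʳ c Fin.zero) (d Fin.zero)

_≐_ : Tableau s n → Tableau s n → Set
X ≐ Y = ∀ i j → X i j ≡ Y i j

◀T-resp-≐ : {X X′ Y Y′ : Tableau s n} → X ≐ X′ → Y ≐ Y′ → X ◀T Y → X′ ◀T Y′
◀T-resp-≐ X≐X′ Y≐Y′ = subst₂ (Lex _◁_) (cols-≐ X≐X′) (cols-≐ Y≐Y′)
  where
  cols-≐ : ∀ {X Y : Tableau s n} → X ≐ Y → cols X ≡ cols Y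
  cols-≐ X≐Y = List.tabulate-cong (λ j → List.tabulate-cong (λ i → X≐Y i j))

Similar : Tableau s n → Tableau s n → Set
Similar {n = n} X Y = Σ (Permutation′ n) λ ρ → Σ (Permutation′ n) λ σ →
  ∀ j → SamePattern (λ i → X (ρ ⟨$⟩ʳ i) (σ ⟨$⟩ʳ j)) (λ i → Y i j)

Similar-refl : (X : Tableau s n) → Similar X X
Similar-refl X = Perm.id , Perm.id , λ j → SamePattern-refl

Similar-trans : {X Y Z : Tableau s n} → Similar X Y → Similar Y Z → Similar X Z
Similar-trans (ρ , σ , pat) (ρ′ , σ′ , pat′) =
  ρ′ ∘ₚ ρ , σ′ ∘ₚ σ ,
  λ j → SamePattern-trans (λ i i′ → pat (σ′ ⟨$⟩ʳ j) (ρ′ ⟨$⟩ʳ i) (ρ′ ⟨$⟩ʳ i′)) (pat′ j)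

Similar-respˡ-≐ : {X X′ Y : Tableau s n} → X ≐ X′ → Similar X Y → Similar X′ Y
Similar-respˡ-≐ X≐X′ (ρ , σ , pat) =
  ρ , σ , λ j → SamePattern-respˡ (λ i → X≐X′ (ρ ⟨$⟩ʳ i) (σ ⟨$⟩ʳ j)) (pat j)

Step⇒Similar : {X Y : Tableau s n} → Step X Y → Similar X Y
Step⇒Similar (rowPerm X σ)   = σ , Perm.id , λ j → SamePattern-refl
Step⇒Similar (colPerm X σ)   = Perm.id , σ , λ j → SamePattern-refl
Step⇒Similar (colBij X j₀ f) = Perm.id , Perm.id , pat
  where
  pat : ∀ j → SamePattern (λ i → X i j) (λ i → if ⌊ j ≟ j₀ ⌋ then f ⟨$⟩ʳ X i j else X i j)
  pat j with j ≟ j₀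
  ... | yes _ = SamePattern-injective (⟨$⟩ʳ-injective f)
  ... | no _  = SamePattern-refl

∼c⇒Similar : {X Y : Tableau s n} → X ∼c Y → Similar X Y
∼c⇒Similar {X = X} ε = Similar-refl X
∼c⇒Similar {X = X} {Z} (_◅_ {j = Y} st Y∼Z) = Similar-trans {X = X} {Y} {Z} (Step⇒Similar st) (∼c⇒Similar Y∼Z)

module _ (X : Tableau s n) (g : Fin n → Permutation′ s) where

  recolourFirst : ∀ k → k ≤ n → Σ (Tableau s n) λ Y → X ∼c Y ×
                  (∀ i j → toℕ j < k → Y i j ≡ g j ⟨$⟩ʳ X i j) × (∀ i j → k ≤ toℕ j → Y i j ≡ X i j)
  recolourFirst zero    _   = X , ε , (λ i j ()) , (λ i j _ → refl)
  recolourFirst (suc k) k<n with Y , X∼Y , done , todo ← recolourFirst k (<⇒≤ k<n) =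
    Y′ , X∼Y ◅◅ (colBij Y j₀ (g j₀) ◅ ε) , done′ , todo′
    where
    j₀ : Fin n
    j₀ = Fin.fromℕ< k<n
    Y′ : Tableau s n
    Y′ i j = if ⌊ j ≟ j₀ ⌋ then g j₀ ⟨$⟩ʳ Y i j else Y i j
    done′ : ∀ i j → toℕ j < suc k → Y′ i j ≡ g j ⟨$⟩ʳ X i j
    done′ i j j<1+k with j ≟ j₀
    ... | yes refl = cong (g j₀ ⟨$⟩ʳ_) (todo i j₀ (ℕ.≤-reflexive (sym (Fin.toℕ-fromℕ< k<n))))
    ... | no j≢j₀  =
      done i j (ℕ.≤∧≢⇒< (ℕ.≤-pred j<1+k)
                        (j≢j₀ ∘ Fin.toℕ-injective ∘ λ e → trans e (sym (Fin.toℕ-fromℕ< k<n))))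
    todo′ : ∀ i j → suc k ≤ toℕ j → Y′ i j ≡ X i j
    todo′ i j k<j with j ≟ j₀
    ... | yes refl = ⊥-elim (ℕ.<-irrefl (sym (Fin.toℕ-fromℕ< k<n)) k<j)
    ... | no _     = todo i j (<⇒≤ k<j)

  recolour : Σ (Tableau s n) λ Y → X ∼c Y × ∀ i j → Y i j ≡ g j ⟨$⟩ʳ X i j
  recolour with Y , X∼Y , done , _ ← recolourFirst n ℕ.≤-refl = Y , X∼Y , λ i j → done i j (Fin.toℕ<n j)

Similar⇒∼c : {X Y : Tableau s n} → Similar X Y → Σ (Tableau s n) λ Y′ → X ∼c Y′ × Y′ ≐ Y
Similar⇒∼c {X = X} {Y} (ρ , σ , pat)
  with Y′ , X′∼Y′ , Y′-ok ← recolour (λ i j → X (ρ ⟨$⟩ʳ i) (σ ⟨$⟩ʳ j))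
                                     (proj₁ ∘ samePattern⇒recolouring ∘ pat) =
  Y′ , rowPerm X ρ ◅ colPerm _ σ ◅ X′∼Y′ ,
  λ i j → trans (Y′-ok i j) (proj₂ (samePattern⇒recolouring (pat j)) i)

Similar-embed : (p : m ≤ s) {X Y : Tableau m n} → Similar X Y ⇔ Similar (embed p X) (embed p Y)
Similar-embed p = mk⇔
  (λ (ρ , σ , pat) → ρ , σ , λ j →
    SamePattern-trans (SamePattern-sym ι-pattern) (SamePattern-trans (pat j) ι-pattern))
  (λ (ρ , σ , pat) → ρ , σ , λ j →
    SamePattern-trans ι-pattern (SamePattern-trans (pat j) (SamePattern-sym ι-pattern)))
  where
  ι-pattern : ∀ {n} {c : Fin n → Fin _} → SamePattern c (λ i → inject≤ (c i) p)
  ι-pattern = SamePattern-injective (Fin.inject≤-injective p p _ _)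

-- Lowering letters outside {α₁,…,αₙ}

-- If every small letter occurred, i₀ together with rows containing them would inject Fin (suc n) into Fin n.
missingSmallLetter : (c : Fin n → Fin s) (i₀ : Fin n) → n ≤ toℕ (c i₀) →
                     Σ (Fin s) λ b → toℕ b < n × ∀ i → c i ≢ b
missingSmallLetter {n} {s} c i₀ big = decide (Fin.all? (λ b → Fin.any? (λ i → c i ≟ ι b)))
  where
  ι : Fin n → Fin s
  ι b = inject≤ b (ℕ.≤-trans big (<⇒≤ (Fin.toℕ<n (c i₀))))
  small : ∀ b → toℕ (ι b) < n
  small b = subst (_< n) (sym (Fin.toℕ-inject≤ b _)) (Fin.toℕ<n b)
  decide : Dec (∀ b → ∃ λ i → c i ≡ ι b) → Σ (Fin s) λ b → toℕ b < n × ∀ i → c i ≢ b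
  decide (no ¬allOccur) with b , b-missing ← Fin.¬∀⟶∃¬ n _ (λ b → Fin.any? (λ i → c i ≟ ι b)) ¬allOccur =
    ι b , small b , λ i e → b-missing (i , e)
  decide (yes allOccur) = ⊥-elim (Fin.<⇒notInjective ℕ.≤-refl injective)
    where
    position : Fin (suc n) → Fin n
    position = i₀ Vector.∷ (proj₁ ∘ allOccur)
    big≢small : ∀ b → i₀ ≢ proj₁ (allOccur b)
    big≢small b e = ℕ.<⇒≱ (small b) (subst (λ x → n ≤ toℕ x) (trans (cong c e) (proj₂ (allOccur b))) big)
    injective : Injective _≡_ _≡_ position
    injective {Fin.zero}  {Fin.zero}  _ = refl
    injective {Fin.zero}  {Fin.suc b} e = ⊥-elim (big≢small b e)
    injective {Fin.suc a} {Fin.zero}  e = ⊥-elim (big≢small a (sym e))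
    injective {Fin.suc a} {Fin.suc b} e = cong Fin.suc (Fin.inject≤-injective _ _ a b
      (trans (sym (proj₂ (allOccur a))) (trans (cong c e) (proj₂ (allOccur b)))))

weight : (Fin n → Fin s) → ℕ
weight {zero}  c = 0
weight {suc n} c = toℕ (c Fin.zero) + weight (c ∘ Fin.suc)

weight-mono-≤ : {c c′ : Fin n → Fin s} → (∀ i → c′ i Fin.≤ c i) → weight c′ ≤ weight c
weight-mono-≤ {zero}  _  = ℕ.z≤n
weight-mono-≤ {suc n} le = ℕ.+-mono-≤ (le Fin.zero) (weight-mono-≤ (le ∘ Fin.suc))

weight-mono-< : {c c′ : Fin n → Fin s} → (∀ i → c′ i Fin.≤ c i) →
                ∀ i₀ → c′ i₀ Fin.< c i₀ → weight c′ < weight c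
weight-mono-< le Fin.zero     lt = ℕ.+-mono-<-≤ lt (weight-mono-≤ (le ∘ Fin.suc))
weight-mono-< le (Fin.suc i₀) lt = ℕ.+-mono-≤-< (le Fin.zero) (weight-mono-< (le ∘ Fin.suc) i₀ lt)

module _ (c : Fin n → Fin s) {i₀ : Fin n} (big : n ≤ toℕ (c i₀))
         {b : Fin s} (small : toℕ b < n) (missing : ∀ i → c i ≢ b) where

  private
    a : Fin s
    a = c i₀

    τ : Permutation′ s
    τ = transpose a b

    b<a : b Fin.< a
    b<a = ℕ.<-≤-trans small big

  lowered : Fin n → Fin s
  lowered i = τ ⟨$⟩ʳ c i

  lowered-pattern : SamePattern c lowered
  lowered-pattern = SamePattern-injective (⟨$⟩ʳ-injective τ)

  lowered-weight : weight lowered < weight c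
  lowered-weight = weight-mono-< le i₀ (subst (Fin._< a) (sym (transpose-matchˡ a b)) b<a)
    where
    le′ : ∀ i → Dec (c i ≡ a) → lowered i Fin.≤ c i
    le′ i (yes ci≡a) =
      subst₂ Fin._≤_ (sym (trans (cong (τ ⟨$⟩ʳ_) ci≡a) (transpose-matchˡ a b))) (sym ci≡a) (<⇒≤ b<a)
    le′ i (no ci≢a)  = ℕ.≤-reflexive (cong toℕ (transpose-fixed ci≢a (missing i)))
    le : ∀ i → lowered i Fin.≤ c i
    le i = le′ i (c i ≟ a)

  lowered-◁ : tabulate lowered ◁ tabulate c
  lowered-◁ =
    inj₁ (inj₂ (trans (𝔭-length (tabulate lowered)) (sym (𝔭-length (tabulate c))) , 𝔭-Lex) , 𝔭-≢) , word-≢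
    where
    count-b-before : count b (tabulate c) ≡ 0
    count-b-before = count-absent (All.tabulate⁺ missing)
    count-b-after : 0 < count b (tabulate lowered)
    count-b-after = count-present (Any.tabulate⁺ i₀ (transpose-matchˡ a b))
    count-unchanged : ∀ k → k Fin.< b → count k (tabulate c) ≡ count k (tabulate lowered)
    count-unchanged k k<b = sym (trans (cong (count k) (sym (List.map-tabulate c (τ ⟨$⟩ʳ_))))
      (count-map (τ ⟨$⟩ʳ_) (λ x → mk⇔ (⟨$⟩ʳ-injective τ ∘ λ e → trans e (sym τk≡k)) λ { refl → τk≡k })
                 (tabulate c)))
      where
      τk≡k : τ ⟨$⟩ʳ k ≡ k
      τk≡k = transpose-fixed (λ e → ℕ.<-irrefl (cong toℕ e) (ℕ.<-trans k<b b<a))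
                             (λ e → ℕ.<-irrefl (cong toℕ e) k<b)
    𝔭-Lex : Lex _<_ (𝔭 (tabulate c)) (𝔭 (tabulate lowered))
    𝔭-Lex = tabulate-Lex-first b count-unchanged
              (subst (_< count b (tabulate lowered)) (sym count-b-before) count-b-after)
    𝔭-≢ : 𝔭 (tabulate lowered) ≢ 𝔭 (tabulate c)
    𝔭-≢ e = ℕ.<-irrefl (sym (trans (tabulate-injective e b) count-b-before)) count-b-after
    word-≢ : tabulate lowered ≢ tabulate c
    word-≢ e = ℕ.<-irrefl (cong toℕ (trans (sym (transpose-matchˡ a b)) (tabulate-injective e i₀))) b<a

minimal⇒small : {T : Tableau s n} → MinimalReduced T → ∀ i j → toℕ (T i j) < n
minimal⇒small {n = n} {T} min i j with n ℕ.≤? toℕ (T i j)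
... | no ≱ = ℕ.≰⇒> ≱
... | yes big with b , small , missing ← missingSmallLetter (λ i → T i j) i big =
  ⊥-elim (tabulate-Lex-pointwise-strict ◁-asym compareColumn j loweredColumn (min T′ (colBij T j τ ◅ ε)))
  where
  τ : Permutation′ _
  τ = transpose (T i j) b
  T′ : Tableau _ n
  T′ i′ k = if ⌊ k ≟ j ⌋ then τ ⟨$⟩ʳ T i′ k else T i′ k
  loweredColumn : col T′ j ◁ col T j
  loweredColumn with j ≟ j
  ... | yes refl = lowered-◁ (λ i → T i j) big small missing
  ... | no j≢j   = ⊥-elim (j≢j refl)
  compareColumn : ∀ k → col T′ k ≡ col T k ⊎ col T′ k ◁ col T k
  compareColumn k with k ≟ j
  ... | yes refl = inj₂ (lowered-◁ (λ i → T i j) big small missing)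
  ... | no _     = inj₁ refl

record Compression (c : Fin n → Fin s) : Set where
  field
    column      : Fin n → Fin s
    small       : ∀ i → toℕ (column i) < n
    samePattern : SamePattern c column
    below       : tabulate column ≡ tabulate c ⊎ tabulate column ◁ tabulate c

compressColumn : (c : Fin n → Fin s) → Acc _<_ (weight c) → Compression c
compressColumn {n} c (acc rs) with Fin.any? (λ i → n ℕ.≤? toℕ (c i))
... | no noneBig = record
  { column = c ; small = λ i → ℕ.≰⇒> (noneBig ∘ (i ,_)) ; samePattern = SamePattern-refl ; below = inj₁ refl }
... | yes (i₀ , big) with b , small , missing ← missingSmallLetter c i₀ big =
  record { column      = column
         ; small       = small′
         ; samePattern = SamePattern-trans (lowered-pattern c big small missing) samePattern
         ; below       = inj₂ ([ (λ e → subst (_◁ _) (sym e) lowered◁) , (λ r → ◁-trans r lowered◁) ]′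
                                 below) }
  where
  open Compression (compressColumn (lowered c big small missing) (rs (lowered-weight c big small missing)))
    renaming (small to small′)
  lowered◁ : tabulate (lowered c big small missing) ◁ tabulate c
  lowered◁ = lowered-◁ c big small missing

compress : (p : n ≤ s) (X : Tableau s n) → Σ (Tableau n n) λ U → Similar X (embed p U) × embed p U ◀T X
compress {n} p X = U , (Perm.id , Perm.id , λ j → SamePattern-respʳ (U-column j) (samePattern j)) ,
                   tabulate-Lex-pointwise λ j →
                     subst (λ w → w ≡ col X j ⊎ w ◁ col X j) (List.tabulate-cong (U-column j)) (below j)
  where
  open module Compressed j = Compression (compressColumn (λ i → X i j) (ℕ.<-wellFounded _))
  U : Tableau n n
  U i j = Fin.fromℕ< (small j i)
  U-column : ∀ j i → column j i ≡ embed p U i j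
  U-column j i = sym (inject≤-fromℕ< p (small j i))

-- Transfer along the embedding

small⇒embed : (p : n ≤ s) {T : Tableau s n} → (∀ i j → toℕ (T i j) < n) →
              Σ (Tableau n n) λ T′ → T ≐ embed p T′
small⇒embed p small = (λ i j → Fin.fromℕ< (small i j)) ,
  λ i j → sym (inject≤-fromℕ< p (small i j))

module _ (p : m ≤ s) {T : Tableau s n} {T′ : Tableau m n} (T≐T′ : T ≐ embed p T′) where

  Cantorian-embed : Cantorian T ⇔ Cantorian T′
  Cantorian-embed = mk⇔
    (λ cant π i e → cant π i (List.tabulate-cong λ j →
      trans (T≐T′ _ j) (trans (cong (λ x → inject≤ x p) (tabulate-injective e j)) (sym (T≐T′ i j)))))
    (λ cant′ π i e → cant′ π i (List.tabulate-cong λ j →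
      Fin.inject≤-injective p p _ _ (trans (sym (T≐T′ _ j)) (trans (tabulate-injective e j) (T≐T′ i j)))))

module _ (p : n ≤ s) {T : Tableau s n} {T′ : Tableau n n} (T≐T′ : T ≐ embed p T′) where

  private
    T′≐T : embed p T′ ≐ T
    T′≐T i j = sym (T≐T′ i j)

  MinimalReduced-embed : MinimalReduced T ⇔ MinimalReduced T′
  MinimalReduced-embed = mk⇔ to from
    where
    to : MinimalReduced T → MinimalReduced T′
    to min T″ T′∼T″
      with Y , T∼Y , Y≐T″ ← Similar⇒∼c (Similar-respˡ-≐ {Y = embed p T″} T′≐T
                                         (Equivalence.to (Similar-embed p {T′} {T″}) (∼c⇒Similar T′∼T″))) =
      Equivalence.from (◀T-embed p) (◀T-resp-≐ T≐T′ Y≐T″ (min Y T∼Y))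
    from : MinimalReduced T′ → MinimalReduced T
    from min′ T″ T∼T″
      with U , T″≈U , U◀T″ ← compress p T″
      with U′ , T′∼U′ , U′≐U ← Similar⇒∼c (Equivalence.from (Similar-embed p {T′} {U})
                                 (Similar-respˡ-≐ T≐T′ (Similar-trans {X = T} {T″} (∼c⇒Similar T∼T″) T″≈U))) =
      ◀T-trans (◀T-resp-≐ T′≐T (λ _ _ → refl)
                 (Equivalence.to (◀T-embed p) (◀T-resp-≐ (λ _ _ → refl) U′≐U (min′ U′ T′∼U′))))
               U◀T″

lemma4p1 : (n s : ℕ) → 2 ≤ n → (n<s : n < s) → (T : Tableau s n) →
    CantorianMinimalReduced T ⇔
      Σ (Tableau n n) (λ T' → (∀ i j → T i j ≡ embed (<⇒≤ n<s) T' i j) × CantorianMinimalReduced T')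
lemma4p1 n s _ n<s T = mk⇔
  (λ (cantorian , minimal) →
    let T′ , T≐T′ = small⇒embed p (minimal⇒small minimal)
    in T′ , T≐T′ , Equivalence.to (Cantorian-embed p T≐T′) cantorian ,
                   Equivalence.to (MinimalReduced-embed p T≐T′) minimal)
  (λ (T′ , T≐T′ , cantorian , minimal) →
    Equivalence.from (Cantorian-embed p T≐T′) cantorian , Equivalence.from (MinimalReduced-embed p T≐T′) minimal)
  where
  p : n ≤ s
  p = <⇒≤ n<s
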